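{- Let $(\vec G=(V,E),\sigma)$ be a properly vertex-colored digraph, $\mathscr V=\{V_1,\dots,V_k\}$ a partition of $V$ with $k\ge 2$, and, for some $1\le i\le k$, let $\mathscr V_i$ be a partition of $V_i$ with $|\mathscr V_i|\ge 2$. Let $\vec G'=\vec G\triangle U(\vec G,\mathscr V)$ be the digraph obtained from $\vec G$ by applying the edits in $U(\vec G,\mathscr V)$ (same coloring $\sigma$). Then $U(\vec G,\mathscr V)\cap U(\vec G'[V_i],\mathscr V_i)=\emptyset$, where $\vec G'[V_i]$ is the induced subgraph with coloring $\sigma_{|V_i}$.
   Context: A digraph $\vec G=(V,E)$ has a finite vertex set and arc set $E\subseteq (V\times V)\setminus\{(v,v)\mid v\in V\}$; for a set $F$ of ordered pairs of distinct vertices, $\vec G\triangle F=(V,E\triangle F)$. A vertex coloring $\sigma$ is proper if adjacent vertices have distinct colors. All rooted trees are phylogenetic (every non-leaf vertex has at least two children); $L(T)$ is the leaf set, $\rho_T$ the root, $T(v)$ the subtree rooted at $v$, $\mathrm{child}_T(v)$ the children of $v$; $u\preceq_T v$ means $v$ lies on the path from $u$ to the root; $\mathrm{lca}_T$ is the last common ancestor. For a tree $T$ with leaf coloring $\sigma$, a leaf $y$ is a best match of a leaf $x$ if $\sigma(x)\ne\sigma(y)$ and $\mathrm{lca}_T(x,y)\preceq_T\mathrm{lca}_T(x,y')$ for all leaves $y'$ with $\sigma(y')=\sigma(y)$; the best match graph $\vec G(T,\sigma)$ has vertex set $L(T)$ and arcs $(x,y)$ whenever $y$ is a best match of $x$.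 For a colored digraph $(\vec H=(W,E_H),\tau)$ and a tree $T$ with $L(T)=W$, $U(\vec H,T)=E_H\,\triangle\,E(\vec G(T,\tau))$. For a partition $\mathscr W$ of $W$ with $|\mathscr W|\ge 2$, $\mathscr T(\mathscr W)$ is the set of phylogenetic trees $T$ with $L(T)=W$ and $\{L(T(v))\mid v\in\mathrm{child}_T(\rho_T)\}=\mathscr W$, and $U(\vec H,\mathscr W)=\bigcap_{T\in\mathscr T(\mathscr W)}U(\vec H,T)$. -}

module Defs where

open import Data.Nat using (ℕ)
open import Data.Fin using (Fin)
open import Data.List using (List; []; _∷_; length; lookup)
open import Data.Product using (Σ; _×_)
open import Data.Sum using (_⊎_)
open import Relation.Nullary using (¬_)
open import Relation.Binary.PropositionalEquality using (_≡_; _≢_)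
open import Function.Bundles using (_⇔_)

-- Rooted phylogenetic trees with leaves labelled by elements of A.
-- A non-leaf vertex has at least two children (node t₁ t₂ ts).

data Tree (A : Set) : Set where
  leaf : A → Tree A
  node : Tree A → Tree A → List (Tree A) → Tree A

children : {A : Set} → Tree A → List (Tree A)
children (leaf _)      = []
children (node a b ts) = a ∷ b ∷ ts

-- Vertices of a tree, given as paths from the root.
data Pos {A : Set} : Tree A → Set where
  here : ∀ {t} → Pos t
  down : ∀ {t} (i : Fin (length (children t))) →
         Pos (lookup (children t) i) → Pos t

subtreeAt : {A : Set} {t : Tree A} → Pos t → Tree A
subtreeAt {t = t} here = t
subtreeAt (down i p)   = subtreeAt p

-- u ⪯ v : v lies on the path from u to the root (v is an ancestor of u or v = u).
data _⪯_ {A : Set} : {t : Tree A} → Pos t → Pos t → Set where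
  ⪯-here : ∀ {t} {p : Pos t} → p ⪯ here
  ⪯-down : ∀ {t} {i : Fin (length (children t))}
             {p q : Pos (lookup (children t) i)} →
           p ⪯ q → down {t = t} i p ⪯ down i q

LeafAt : {A : Set} {t : Tree A} → Pos t → A → Set
LeafAt p x = subtreeAt p ≡ leaf x

_∈L_ : {A : Set} → A → Tree A → Set
x ∈L t = Σ (Pos t) λ p → LeafAt p x

-- leaf labels are distinct (so the leaves are identified with their labels)
UniqueLeaves : {A : Set} → Tree A → Set
UniqueLeaves {A} t = ∀ {x : A} (p q : Pos t) → LeafAt p x → LeafAt q x → p ≡ q

IsLCA : {A : Set} {t : Tree A} → Pos t → Pos t → Pos t → Set
IsLCA {t = t} p q r = p ⪯ r × q ⪯ r × (∀ (r' : Pos t) → p ⪯ r' → q ⪯ r' → r ⪯ r')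

BestMatch : {A C : Set} → Tree A → (A → C) → A → A → Set
BestMatch {A} T σ x y =
  x ∈L T × y ∈L T × σ x ≢ σ y ×
  (∀ (px py : Pos T) (y' : A) (py' : Pos T) (a a' : Pos T) →
     LeafAt px x → LeafAt py y → LeafAt py' y' → σ y' ≡ σ y →
     IsLCA px py a → IsLCA px py' a' → a ⪯ a')

Xor : Set → Set → Set
Xor P Q = (P × ¬ Q) ⊎ (¬ P × Q)

_△_ : {V : Set} → (V → V → Set) → (V → V → Set) → V → V → Set
(E △ F) x y = Xor (E x y) (F x y)

-- A partition of the vertex subset W ⊆ Fin n into `size` nonempty blocks;
-- block j is {x | W x and block x = j}.

record Partition (n : ℕ) (W : Fin n → Set) : Set₁ where
  field
    size     : ℕ
    block    : Fin n → Fin size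
    nonempty : ∀ (j : Fin size) → Σ (Fin n) λ x → W x × block x ≡ j

Block : {n : ℕ} {W : Fin n → Set} (P : Partition n W) → Fin (Partition.size P) → Fin n → Set
Block {W = W} P j x = W x × Partition.block P x ≡ j

-- T ∈ 𝒯(𝒲): L(T) = W and {L(T(v)) | v ∈ child(ρ_T)} = 𝒲 (as sets of sets).
InTrees : {n : ℕ} {W : Fin n → Set} → Partition n W → Tree (Fin n) → Set
InTrees {n} {W} P T =
  UniqueLeaves T ×
  (∀ (x : Fin n) → (x ∈L T) ⇔ W x) ×
  (∀ (c : Fin (length (children T))) → Σ (Fin (Partition.size P)) λ j →
      ∀ (x : Fin n) → (x ∈L lookup (children T) c) ⇔ Block P j x) ×
  (∀ (j : Fin (Partition.size P)) → Σ (Fin (length (children T))) λ c →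
      ∀ (x : Fin n) → (x ∈L lookup (children T) c) ⇔ Block P j x)

-- U(H, T) = E_H △ E(G(T, τ))   (arcs of H are assumed to lie in W × W)
U-tree : {n : ℕ} {C : Set} → (Fin n → Fin n → Set) → (Fin n → C) →
         Tree (Fin n) → Fin n → Fin n → Set
U-tree E τ T = E △ BestMatch T τ

U-part : {n : ℕ} {C : Set} {W : Fin n → Set} → (Fin n → Fin n → Set) → (Fin n → C) →
         Partition n W → Fin n → Fin n → Set
U-part {n} E τ P x y = ∀ (T : Tree (Fin n)) → InTrees P T → U-tree E τ T x y

Induced : {n : ℕ} → (Fin n → Fin n → Set) → (Fin n → Set) → Fin n → Fin n → Set
Induced E W x y = W x × W y × E x y

-- Let (x, y) be an edit of U(G, 𝒱) that is also an edit of U(G'[Vᵢ], 𝒱ᵢ). Then x, y ∈ Vᵢ and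
-- σ x ≠ σ y. Some T ∈ 𝒯(𝒱) has the cherry (x, y) inside the subtree for Vᵢ; there y is a best
-- match of x, so (x, y) ∈ U(G, T) forces (x, y) ∉ G: the edit inserts the arc, and
-- (x, y) ∈ G'[Vᵢ]. If some z ≠ y in Vᵢ had the colour of y, a tree of 𝒯(𝒱) with the cherry
-- (x, z) would make y no best match of x while (x, y) ∉ G, so (x, y) ∉ U(G, 𝒱). Hence y is the
-- only vertex of its colour in Vᵢ, so y is a best match of x in every tree on Vᵢ, and
-- (x, y) ∉ U(G'[Vᵢ], 𝒱ᵢ).
module Submission where

open import Defs
open import Data.Nat using (ℕ; _≤_; suc; s≤s)
open import Data.Fin using (Fin; zero; suc; cast) renaming (_≟_ to _≟ᶠ_)
open import Data.Fin.Properties using (cast-involutive)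
open import Data.Bool using (Bool; true; false)
open import Data.Unit using (⊤; tt)
open import Data.Empty using (⊥; ⊥-elim)
open import Data.List using (List; []; _∷_; length; lookup; tabulate; filter; allFin)
open import Data.List.Properties using (length-tabulate; lookup-tabulate)
open import Data.List.Membership.Propositional using (_∈_; _∉_)
open import Data.List.Membership.Propositional.Properties using (∈-filter⁺; ∈-filter⁻; ∈-allFin)
open import Data.List.Relation.Unary.Any using (here; there)
open import Data.List.Relation.Unary.All as All using ()
open import Data.List.Relation.Unary.AllPairs using (_∷_)
open import Data.List.Relation.Unary.Unique.Propositional using (Unique)
open import Data.List.Relation.Unary.Unique.Propositional.Properties using (allFin⁺; filter⁺)
open import Data.Product using (Σ; _×_; _,_; proj₁; proj₂)
open import Data.Sum using (_⊎_; inj₁; inj₂)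
open import Function.Bundles using (_⇔_; mk⇔; Equivalence)
open import Relation.Nullary using (¬_; yes; no)
open import Relation.Nullary.Decidable using (_×-dec_; _⊎-dec_; ¬?)
open import Relation.Unary using (Decidable)
open import Relation.Binary.PropositionalEquality
  using (_≡_; _≢_; refl; sym; trans; cong; subst; module ≡-Reasoning)

open Equivalence using (to; from)

Xor-both : ∀ {P Q : Set} → P → Q → ¬ Xor P Q
Xor-both p q (inj₁ (_ , ¬q)) = ¬q q
Xor-both p q (inj₂ (¬p , _)) = ¬p p

module _ {A : Set} where

  _hasLeaves_ : Tree A → (A → Set) → Set
  t hasLeaves S = ∀ x → (x ∈L t) ⇔ S x

  _occursIn_ : Tree A → Tree A → Set
  t occursIn T = Σ (Pos T) λ c → subtreeAt c ≡ t

  ∈L-leaf⁻ : ∀ {x a : A} → x ∈L leaf a → x ≡ a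
  ∈L-leaf⁻ (here , refl) = refl
  ∈L-leaf⁻ (down () _ , _)

  ∈L-leaf⁺ : ∀ (a : A) → a ∈L leaf a
  ∈L-leaf⁺ a = here , refl

  leaf-UniqueLeaves : ∀ (a : A) → UniqueLeaves (leaf a)
  leaf-UniqueLeaves a here here _ _ = refl

  ∈L-child⁺ : ∀ {t : Tree A} {x} (c : Fin (length (children t))) →
              x ∈L lookup (children t) c → x ∈L t
  ∈L-child⁺ c (p , e) = down c p , e

  occursIn-child : ∀ {T t : Tree A} (c : Fin (length (children T))) →
                   t occursIn lookup (children T) c → t occursIn T
  occursIn-child c (p , e) = down c p , e

  ∈L-node⁻ : ∀ {t u : Tree A} {ts x} → x ∈L node t u ts →
             Σ (Fin (length (children (node t u ts)))) λ c → x ∈L lookup (children (node t u ts)) c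
  ∈L-node⁻ (down c p , e) = c , p , e

  UniqueLeaves-node : ∀ {t : Tree A} →
    (∀ c → UniqueLeaves (lookup (children t) c)) →
    (∀ {x} c c' → x ∈L lookup (children t) c → x ∈L lookup (children t) c' → c ≡ c') →
    UniqueLeaves t
  UniqueLeaves-node {leaf a} _ _ = leaf-UniqueLeaves a
  UniqueLeaves-node {node _ _ _} _ _ here _ () _
  UniqueLeaves-node {node _ _ _} _ _ (down _ _) here _ ()
  UniqueLeaves-node {node _ _ _} unique separate (down c p) (down c' q) e e'
    with separate c c' (p , e) (q , e')
  ... | refl = cong (down c) (unique c p q e e')

  node₂-UniqueLeaves : ∀ {t u : Tree A} → UniqueLeaves t → UniqueLeaves u →
                       (∀ {x} → x ∈L t → x ∈L u → ⊥) → UniqueLeaves (node t u [])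
  node₂-UniqueLeaves {t} {u} ut uu disjoint = UniqueLeaves-node unique separate
    where
    unique : ∀ c → UniqueLeaves (lookup (t ∷ u ∷ []) c)
    unique zero       = ut
    unique (suc zero) = uu
    separate : ∀ {x} c c' → x ∈L lookup (t ∷ u ∷ []) c → x ∈L lookup (t ∷ u ∷ []) c' → c ≡ c'
    separate zero       zero       _ _  = refl
    separate zero       (suc zero) m m' = ⊥-elim (disjoint m m')
    separate (suc zero) zero       m m' = ⊥-elim (disjoint m' m)
    separate (suc zero) (suc zero) _ _  = refl

  ⪯-trans : ∀ {t : Tree A} {p q r : Pos t} → p ⪯ q → q ⪯ r → p ⪯ r
  ⪯-trans _          ⪯-here     = ⪯-here
  ⪯-trans (⪯-down a) (⪯-down b) = ⪯-down (⪯-trans a b)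

  ancestors-comparable : ∀ {t : Tree A} {p q r : Pos t} → p ⪯ q → p ⪯ r → q ⪯ r ⊎ r ⪯ q
  ancestors-comparable _          ⪯-here     = inj₁ ⪯-here
  ancestors-comparable ⪯-here     (⪯-down _) = inj₂ ⪯-here
  ancestors-comparable (⪯-down a) (⪯-down b) with ancestors-comparable a b
  ... | inj₁ q⪯r = inj₁ (⪯-down q⪯r)
  ... | inj₂ r⪯q = inj₂ (⪯-down r⪯q)

  ∈L-subtreeAt⁺ : ∀ {t : Tree A} {p q : Pos t} {y} → p ⪯ q → LeafAt p y → y ∈L subtreeAt q
  ∈L-subtreeAt⁺ {p = p} ⪯-here e = p , e
  ∈L-subtreeAt⁺ (⪯-down p⪯q) e  = ∈L-subtreeAt⁺ p⪯q e

  ∈L-subtreeAt⁻ : ∀ {t : Tree A} (c : Pos t) {y} → y ∈L subtreeAt c →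
                  Σ (Pos t) λ p → LeafAt p y × p ⪯ c
  ∈L-subtreeAt⁻ here (p , e) = p , e , ⪯-here
  ∈L-subtreeAt⁻ (down i c) m with ∈L-subtreeAt⁻ c m
  ... | p , e , p⪯c = down i p , e , ⪯-down p⪯c

  lca : ∀ {t : Tree A} → Pos t → Pos t → Pos t
  lca here       _          = here
  lca (down _ _) here       = here
  lca (down i p) (down j q) with i ≟ᶠ j
  ... | yes refl = down i (lca p q)
  ... | no _     = here

  lca-IsLCA : ∀ {t : Tree A} (p q : Pos t) → IsLCA p q (lca p q)
  lca-IsLCA here       _    = ⪯-here , ⪯-here , λ _ p⪯r _ → p⪯r
  lca-IsLCA (down _ _) here = ⪯-here , ⪯-here , λ _ _ q⪯r → q⪯r
  lca-IsLCA (down i p) (down j q) with i ≟ᶠ j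
  ... | yes refl =
    let (p⪯a , q⪯a , least) = lca-IsLCA p q
    in ⪯-down p⪯a , ⪯-down q⪯a , least-down least
    where
    least-down : ∀ {a} → (∀ r → p ⪯ r → q ⪯ r → a ⪯ r) →
                 ∀ r → down i p ⪯ r → down i q ⪯ r → down i a ⪯ r
    least-down _     here       _          _          = ⪯-here
    least-down least (down _ r) (⪯-down p⪯r) (⪯-down q⪯r) = ⪯-down (least r p⪯r q⪯r)
  ... | no i≢j = ⪯-here , ⪯-here , least
    where
    least : ∀ r → down i p ⪯ r → down j q ⪯ r → here ⪯ r
    least here       _          _          = ⪯-here
    least (down _ _) (⪯-down _) (⪯-down _) = ⊥-elim (i≢j refl)

  cherry : A → A → Tree A
  cherry a b = node (leaf a) (leaf b) []

  ∈L-cherry⁻ : ∀ {a b x : A} → x ∈L cherry a b → x ≡ a ⊎ x ≡ b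
  ∈L-cherry⁻ (down zero p , e)       = inj₁ (∈L-leaf⁻ (p , e))
  ∈L-cherry⁻ (down (suc zero) p , e) = inj₂ (∈L-leaf⁻ (p , e))

  ∈L-cherry⁺ : ∀ {a b x : A} → x ≡ a ⊎ x ≡ b → x ∈L cherry a b
  ∈L-cherry⁺ {a} (inj₁ refl) = ∈L-child⁺ zero (∈L-leaf⁺ a)
  ∈L-cherry⁺ {b = b} (inj₂ refl) = ∈L-child⁺ (suc zero) (∈L-leaf⁺ b)

  cherry-UniqueLeaves : ∀ {a b : A} → a ≢ b → UniqueLeaves (cherry a b)
  cherry-UniqueLeaves {a} {b} a≢b = node₂-UniqueLeaves (leaf-UniqueLeaves a) (leaf-UniqueLeaves b)
    λ m m' → a≢b (trans (sym (∈L-leaf⁻ m)) (∈L-leaf⁻ m'))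

  ∈L-cherry-below : ∀ {T : Tree A} {a b y} {c q : Pos T} → subtreeAt c ≡ cherry a b →
                    q ⪯ c → LeafAt q y → y ≡ a ⊎ y ≡ b
  ∈L-cherry-below {y = y} c≡ab q⪯c e = ∈L-cherry⁻ (subst (y ∈L_) c≡ab (∈L-subtreeAt⁺ q⪯c e))

  cherry-leaf : ∀ {T : Tree A} {a b y} (c : Pos T) → subtreeAt c ≡ cherry a b →
                y ≡ a ⊎ y ≡ b → Σ (Pos T) λ p → LeafAt p y × p ⪯ c
  cherry-leaf {y = y} c c≡ab y∈ab = ∈L-subtreeAt⁻ c (subst (y ∈L_) (sym c≡ab) (∈L-cherry⁺ y∈ab))

module _ {A C : Set} (σ : A → C) where

  cherry-BestMatch : ∀ {T : Tree A} {x y} → UniqueLeaves T → cherry x y occursIn T →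
                     σ x ≢ σ y → BestMatch T σ x y
  cherry-BestMatch {T} {x} {y} unique (c , c≡xy) σx≢σy
    with cherry-leaf c c≡xy (inj₁ refl) | cherry-leaf c c≡xy (inj₂ refl)
  ... | qx , ex , _ | qy , ey , _ = (qx , ex) , (qy , ey) , σx≢σy , best
    where
    below : ∀ {z p} → z ≡ x ⊎ z ≡ y → LeafAt p z → p ⪯ c
    below {p = p} z∈xy e with cherry-leaf c c≡xy z∈xy
    ... | q , e' , q⪯c = subst (_⪯ c) (sym (unique p q e e')) q⪯c
    best : ∀ (px py : Pos T) (y' : A) (py' : Pos T) (a a' : Pos T) →
           LeafAt px x → LeafAt py y → LeafAt py' y' → σ y' ≡ σ y →
           IsLCA px py a → IsLCA px py' a' → a ⪯ a'
    best px py y' py' a a' ex ey ey' σy'≡σy (_ , _ , least) (px⪯a' , py'⪯a' , _)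
      with ancestors-comparable (below (inj₁ refl) ex) px⪯a'
    ... | inj₁ c⪯a' = ⪯-trans (least c (below (inj₁ refl) ex) (below (inj₂ refl) ey)) c⪯a'
    ... | inj₂ a'⪯c with ∈L-cherry-below c≡xy (⪯-trans py'⪯a' a'⪯c) ey'
    ...   | inj₁ refl = ⊥-elim (σx≢σy σy'≡σy)
    ...   | inj₂ refl = least a' px⪯a' (subst (_⪯ a') (unique py' py ey' ey) py'⪯a')

  cherry-¬BestMatch : ∀ {T : Tree A} {x y z} → cherry x z occursIn T → y ∈L T →
                      y ≢ x → y ≢ z → σ z ≡ σ y → ¬ BestMatch T σ x y
  cherry-¬BestMatch {x = x} {y} {z} (c , c≡xz) (py , ey) y≢x y≢z σz≡σy (_ , _ , _ , best)
    with cherry-leaf c c≡xz (inj₁ refl) | cherry-leaf c c≡xz (inj₂ refl)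
  ... | qx , ex , qx⪯c | qz , ez , qz⪯c
    with ∈L-cherry-below c≡xz (⪯-trans py⪯lca[x,y] (⪯-trans lca[x,y]⪯lca[x,z] lca[x,z]⪯c)) ey
    where
    py⪯lca[x,y] = proj₁ (proj₂ (lca-IsLCA qx py))
    lca[x,y]⪯lca[x,z] = best qx py z qz _ _ ex ey ez σz≡σy (lca-IsLCA qx py) (lca-IsLCA qx qz)
    lca[x,z]⪯c = proj₂ (proj₂ (lca-IsLCA qx qz)) c qx⪯c qz⪯c
  ... | inj₁ y≡x = y≢x y≡x
  ... | inj₂ y≡z = y≢z y≡z

  colour-unique-BestMatch : ∀ {T : Tree A} {x y} → UniqueLeaves T → x ∈L T → y ∈L T →
                            σ x ≢ σ y → (∀ {y'} → y' ∈L T → σ y' ≡ σ y → y' ≡ y) →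
                            BestMatch T σ x y
  colour-unique-BestMatch {T} {x} {y} unique x∈T y∈T σx≢σy only-y = x∈T , y∈T , σx≢σy , best
    where
    best : ∀ (px py : Pos T) (y' : A) (py' : Pos T) (a a' : Pos T) →
           LeafAt px x → LeafAt py y → LeafAt py' y' → σ y' ≡ σ y →
           IsLCA px py a → IsLCA px py' a' → a ⪯ a'
    best px py y' py' a a' _ ey ey' σy'≡σy (_ , _ , least) (px⪯a' , py'⪯a' , _)
      with only-y (py' , ey') σy'≡σy
    ... | refl = least a' px⪯a' (subst (_⪯ a') (unique py' py ey' ey) py'⪯a')

module _ {A : Set} where

  comb : Tree A → List A → Tree A
  comb t []       = t
  comb t (b ∷ bs) = node t (comb (leaf b) bs) []

  ∈L-comb⁻ : ∀ t bs {x} → x ∈L comb t bs → x ∈L t ⊎ x ∈ bs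
  ∈L-comb⁻ t []       m                 = inj₁ m
  ∈L-comb⁻ t (b ∷ bs) (down zero p , e) = inj₁ (p , e)
  ∈L-comb⁻ t (b ∷ bs) (down (suc zero) p , e) with ∈L-comb⁻ (leaf b) bs (p , e)
  ... | inj₁ x∈b  = inj₂ (here (∈L-leaf⁻ x∈b))
  ... | inj₂ x∈bs = inj₂ (there x∈bs)

  ∈L-comb⁺ : ∀ t bs {x} → x ∈L t ⊎ x ∈ bs → x ∈L comb t bs
  ∈L-comb⁺ t []       (inj₁ x∈t)         = x∈t
  ∈L-comb⁺ t (b ∷ bs) (inj₁ x∈t)         = ∈L-child⁺ zero x∈t
  ∈L-comb⁺ t (b ∷ bs) (inj₂ (here refl)) = ∈L-child⁺ (suc zero) (∈L-comb⁺ (leaf b) bs (inj₁ (∈L-leaf⁺ b)))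
  ∈L-comb⁺ t (b ∷ bs) (inj₂ (there x∈bs)) = ∈L-child⁺ (suc zero) (∈L-comb⁺ (leaf b) bs (inj₂ x∈bs))

  comb-UniqueLeaves : ∀ t bs → UniqueLeaves t → Unique bs → (∀ {x} → x ∈L t → x ∉ bs) →
                      UniqueLeaves (comb t bs)
  comb-UniqueLeaves t []       ut _                  _        = ut
  comb-UniqueLeaves t (b ∷ bs) ut (b∉bs ∷ unique-bs) disjoint =
    node₂-UniqueLeaves ut
      (comb-UniqueLeaves (leaf b) bs (leaf-UniqueLeaves b) unique-bs
         λ x∈b x∈bs → All.lookup b∉bs x∈bs (sym (∈L-leaf⁻ x∈b)))
      λ x∈t x∈comb → disjoint x∈t (∈-spine x∈comb)
    where
    ∈-spine : ∀ {x} → x ∈L comb (leaf b) bs → x ∈ b ∷ bs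
    ∈-spine m with ∈L-comb⁻ (leaf b) bs m
    ... | inj₁ x∈b  = here (∈L-leaf⁻ x∈b)
    ... | inj₂ x∈bs = there x∈bs

  comb-seed : ∀ t bs → t occursIn comb t bs
  comb-seed t []       = here , refl
  comb-seed t (b ∷ bs) = down zero here , refl

  join : (s : ℕ) → 2 ≤ s → (Fin s → Tree A) → Tree A
  join (suc (suc _)) (s≤s (s≤s _)) f = node (f zero) (f (suc zero)) (tabulate λ k → f (suc (suc k)))

  childIndex : ∀ {s} h (f : Fin s → Tree A) → Fin (length (children (join s h f))) → Fin s
  childIndex {suc (suc _)} (s≤s (s≤s _)) f = cast (length-tabulate f)

  childOf : ∀ {s} h (f : Fin s → Tree A) → Fin s → Fin (length (children (join s h f)))
  childOf {suc (suc _)} (s≤s (s≤s _)) f = cast (sym (length-tabulate f))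

  childIndex-childOf : ∀ {s} h (f : Fin s → Tree A) j → childIndex h f (childOf h f j) ≡ j
  childIndex-childOf {suc (suc _)} (s≤s (s≤s _)) f = cast-involutive (length-tabulate f) (sym (length-tabulate f))

  childOf-childIndex : ∀ {s} h (f : Fin s → Tree A) c → childOf h f (childIndex h f c) ≡ c
  childOf-childIndex {suc (suc _)} (s≤s (s≤s _)) f = cast-involutive (sym (length-tabulate f)) (length-tabulate f)

  childIndex-injective : ∀ {s} h (f : Fin s → Tree A) {c c'} →
                         childIndex h f c ≡ childIndex h f c' → c ≡ c'
  childIndex-injective h f {c} {c'} e = begin
    c                               ≡⟨ sym (childOf-childIndex h f c) ⟩
    childOf h f (childIndex h f c)  ≡⟨ cong (childOf h f) e ⟩
    childOf h f (childIndex h f c') ≡⟨ childOf-childIndex h f c' ⟩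
    c'                              ∎
    where open ≡-Reasoning

  lookup-join : ∀ {s} h (f : Fin s → Tree A) c →
                lookup (children (join s h f)) c ≡ f (childIndex h f c)
  lookup-join {suc (suc _)} h@(s≤s (s≤s _)) f c = begin
    lookup (tabulate f) c
      ≡⟨ cong (lookup (tabulate f)) (sym (childOf-childIndex h f c)) ⟩
    lookup (tabulate f) (childOf h f (childIndex h f c))
      ≡⟨ lookup-tabulate f (childIndex h f c) ⟩
    f (childIndex h f c)
      ∎
    where open ≡-Reasoning

  lookup-childOf : ∀ {s} h (f : Fin s → Tree A) j → lookup (children (join s h f)) (childOf h f j) ≡ f j
  lookup-childOf h f j = trans (lookup-join h f _) (cong f (childIndex-childOf h f j))

  ∈L-join⁻ : ∀ {s} h (f : Fin s → Tree A) {x} → x ∈L join s h f → Σ (Fin s) λ j → x ∈L f j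
  ∈L-join⁻ {suc (suc _)} h@(s≤s (s≤s _)) f {x} m with ∈L-node⁻ m
  ... | c , m' = childIndex h f c , subst (x ∈L_) (lookup-join h f c) m'

  ∈L-join⁺ : ∀ {s} h (f : Fin s → Tree A) {x} j → x ∈L f j → x ∈L join s h f
  ∈L-join⁺ h f {x} j m = ∈L-child⁺ (childOf h f j) (subst (x ∈L_) (sym (lookup-childOf h f j)) m)

  join-UniqueLeaves : ∀ {s} h (f : Fin s → Tree A) → (∀ j → UniqueLeaves (f j)) →
                      (∀ {x} j j' → x ∈L f j → x ∈L f j' → j ≡ j') → UniqueLeaves (join s h f)
  join-UniqueLeaves h f unique separate = UniqueLeaves-node
    (λ c → subst UniqueLeaves (sym (lookup-join h f c)) (unique (childIndex h f c)))
    (λ {x} c c' m m' → childIndex-injective h f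
       (separate _ _ (subst (x ∈L_) (lookup-join h f c) m) (subst (x ∈L_) (lookup-join h f c') m')))

  occursIn-join : ∀ {s} h (f : Fin s → Tree A) {t} j → t occursIn f j → t occursIn join s h f
  occursIn-join h f {t} j occ =
    occursIn-child (childOf h f j) (subst (t occursIn_) (sym (lookup-childOf h f j)) occ)

module _ {n : ℕ} {W : Fin n → Set} (P : Partition n W) where
  open Partition P

  IsBlockTree : Fin size → Tree (Fin n) → Set
  IsBlockTree j t = UniqueLeaves t × t hasLeaves Block P j

  join-InTrees : (h : 2 ≤ size) (f : Fin size → Tree (Fin n)) →
                 (∀ j → IsBlockTree j (f j)) → InTrees P (join size h f)
  join-InTrees h f blockTrees = unique , leaves , blockOfChild , childOfBlock
    where
    unique : UniqueLeaves (join size h f)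
    unique = join-UniqueLeaves h f (λ j → proj₁ (blockTrees j)) λ {x} j j' m m' →
      trans (sym (proj₂ (to (proj₂ (blockTrees j) x) m))) (proj₂ (to (proj₂ (blockTrees j') x) m'))
    leaves : join size h f hasLeaves W
    leaves x = mk⇔
      (λ m → let (j , m') = ∈L-join⁻ h f m in proj₁ (to (proj₂ (blockTrees j) x) m'))
      (λ w → ∈L-join⁺ h f (block x) (from (proj₂ (blockTrees (block x)) x) (w , refl)))
    blockOfChild : ∀ c → Σ (Fin size) λ j → lookup (children (join size h f)) c hasLeaves Block P j
    blockOfChild c = childIndex h f c ,
      subst (_hasLeaves Block P (childIndex h f c)) (sym (lookup-join h f c)) (proj₂ (blockTrees _))
    childOfBlock : ∀ j → Σ _ λ c → lookup (children (join size h f)) c hasLeaves Block P j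
    childOfBlock j = childOf h f j ,
      subst (λ k → lookup (children (join size h f)) (childOf h f j) hasLeaves Block P k)
            (childIndex-childOf h f j) (proj₂ (blockOfChild (childOf h f j)))

  module _ (W? : Decidable W) where

    outside? : ∀ j {D : Fin n → Set} → Decidable D → Decidable (λ z → Block P j z × ¬ D z)
    outside? j D? z = (W? z ×-dec (block z ≟ᶠ j)) ×-dec ¬? (D? z)

    -- The seed t prescribes part of the block tree (below: a cherry).
    blockComb : ∀ j {D : Fin n → Set} → Decidable D → Tree (Fin n) → Tree (Fin n)
    blockComb j D? t = comb t (filter (outside? j D?) (allFin n))

    blockComb-IsBlockTree : ∀ j {D} (D? : Decidable D) {t} → UniqueLeaves t → t hasLeaves D →
                            (∀ {x} → D x → Block P j x) → IsBlockTree j (blockComb j D? t)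
    blockComb-IsBlockTree j {D} D? {t} ut t≈D D⊆j = unique , leaves
      where
      Q? = outside? j D?
      unique = comb-UniqueLeaves t _ ut (filter⁺ Q? (allFin⁺ n))
                 λ {x} x∈t x∈rest → proj₂ (proj₂ (∈-filter⁻ Q? {xs = allFin n} x∈rest)) (to (t≈D x) x∈t)
      leaves : blockComb j D? t hasLeaves Block P j
      leaves x = mk⇔ block-of-leaf leaf-of-block
        where
        block-of-leaf : x ∈L blockComb j D? t → Block P j x
        block-of-leaf m with ∈L-comb⁻ t _ m
        ... | inj₁ x∈t    = D⊆j (to (t≈D x) x∈t)
        ... | inj₂ x∈rest = proj₁ (proj₂ (∈-filter⁻ Q? {xs = allFin n} x∈rest))
        leaf-of-block : Block P j x → x ∈L blockComb j D? t
        leaf-of-block bx with D? x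
        ... | yes dx = ∈L-comb⁺ t _ (inj₁ (from (t≈D x) dx))
        ... | no ¬dx = ∈L-comb⁺ t _ (inj₂ (∈-filter⁺ Q? (∈-allFin x) (bx , ¬dx)))

    leafComb : Fin size → Tree (Fin n)
    leafComb j = blockComb j (_≟ᶠ proj₁ (nonempty j)) (leaf (proj₁ (nonempty j)))

    leafComb-IsBlockTree : ∀ j → IsBlockTree j (leafComb j)
    leafComb-IsBlockTree j = blockComb-IsBlockTree j (_≟ᶠ w) (leaf-UniqueLeaves w)
      (λ x → mk⇔ ∈L-leaf⁻ λ { refl → ∈L-leaf⁺ w }) λ { refl → proj₂ (nonempty j) }
      where w = proj₁ (nonempty j)

    exists-InTrees : 2 ≤ size → Σ (Tree (Fin n)) (InTrees P)
    exists-InTrees h = join size h leafComb , join-InTrees h leafComb leafComb-IsBlockTree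

    exists-InTrees-with-cherry : 2 ≤ size → ∀ {i a b} → a ≢ b → Block P i a → Block P i b →
                                 Σ (Tree (Fin n)) λ T → InTrees P T × cherry a b occursIn T
    exists-InTrees-with-cherry h {i} {a} {b} a≢b ba bb =
      join size h f , join-InTrees h f f-IsBlockTree , occursIn-join h f i cherry-in-f
      where
      a∨b? : Decidable (λ z → z ≡ a ⊎ z ≡ b)
      a∨b? z = (z ≟ᶠ a) ⊎-dec (z ≟ᶠ b)
      f : Fin size → Tree (Fin n)
      f j with j ≟ᶠ i
      ... | yes _ = blockComb i a∨b? (cherry a b)
      ... | no _  = leafComb j
      f-IsBlockTree : ∀ j → IsBlockTree j (f j)
      f-IsBlockTree j with j ≟ᶠ i
      ... | yes refl = blockComb-IsBlockTree i a∨b? (cherry-UniqueLeaves a≢b)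
                         (λ x → mk⇔ ∈L-cherry⁻ ∈L-cherry⁺) λ { (inj₁ refl) → ba ; (inj₂ refl) → bb }
      ... | no _     = leafComb-IsBlockTree j
      cherry-in-f : cherry a b occursIn f i
      cherry-in-f with i ≟ᶠ i
      ... | yes _  = comb-seed (cherry a b) _
      ... | no i≢i = ⊥-elim (i≢i refl)

module Edits {C : Set} {n : ℕ} {W : Fin n → Set} (P : Partition n W) (W? : Decidable W)
         (h : 2 ≤ Partition.size P) (E : Fin n → Fin n → Set) (σ : Fin n → C) where

  U-part-⊆ : (∀ {x y} → E x y → W x × W y) → ∀ {x y} → U-part E σ P x y → W x × W y
  U-part-⊆ E⊆W {x} {y} xy∈U with exists-InTrees P W? h
  ... | T , T∈ with xy∈U T T∈
  ...   | inj₁ (xy∈E , _)         = E⊆W xy∈E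
  ...   | inj₂ (_ , x∈T , y∈T , _) = to (proj₁ (proj₂ T∈) x) x∈T , to (proj₁ (proj₂ T∈) y) y∈T

  U-part-properlyColoured : (∀ {x y} → E x y → σ x ≢ σ y) → ∀ {x y} → U-part E σ P x y → σ x ≢ σ y
  U-part-properlyColoured proper {x} {y} xy∈U with exists-InTrees P W? h
  ... | T , T∈ with xy∈U T T∈
  ...   | inj₁ (xy∈E , _)          = proper xy∈E
  ...   | inj₂ (_ , _ , _ , σx≢σy , _) = σx≢σy

  module _ {i x y} (bx : Block P i x) (by : Block P i y) (σx≢σy : σ x ≢ σ y)
           (xy∈U : U-part E σ P x y) where

    U-part-inBlock-insertion : ¬ E x y
    U-part-inBlock-insertion xy∈E with exists-InTrees-with-cherry P W? h (λ { refl → σx≢σy refl }) bx by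
    ... | T , T∈ , xy-cherry =
      Xor-both xy∈E (cherry-BestMatch σ (proj₁ T∈) xy-cherry σx≢σy) (xy∈U T T∈)

    U-part-inBlock-colourUnique : ∀ {z} → Block P i z → σ z ≡ σ y → z ≡ y
    U-part-inBlock-colourUnique {z} bz σz≡σy with z ≟ᶠ y
    ... | yes z≡y = z≡y
    ... | no z≢y with exists-InTrees-with-cherry P W? h x≢z bx bz
      where x≢z : x ≢ z
            x≢z refl = σx≢σy σz≡σy
    ...   | T , T∈ , xz-cherry with xy∈U T T∈
    ...     | inj₁ (xy∈E , _) = ⊥-elim (U-part-inBlock-insertion xy∈E)
    ...     | inj₂ (_ , bm)   = ⊥-elim (cherry-¬BestMatch σ xz-cherry
                                  (from (proj₁ (proj₂ T∈) y) (proj₁ by))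
                                  (λ { refl → σx≢σy refl }) (λ y≡z → z≢y (sym y≡z)) σz≡σy bm)

lemma7 : {C : Set} (n : ℕ) (E : Fin n → Fin n → Bool) (σ : Fin n → C) →
    (∀ (x : Fin n) → E x x ≡ false) →
    (∀ (x y : Fin n) → E x y ≡ true → σ x ≢ σ y) →
    (𝒱 : Partition n (λ _ → ⊤)) → 2 ≤ Partition.size 𝒱 →
    (i : Fin (Partition.size 𝒱)) →
    (𝒱ᵢ : Partition n (λ x → Partition.block 𝒱 x ≡ i)) → 2 ≤ Partition.size 𝒱ᵢ →
    ∀ (x y : Fin n) →
    U-part (λ a b → E a b ≡ true) σ 𝒱 x y →
    U-part (Induced ((λ a b → E a b ≡ true) △ U-part (λ a b → E a b ≡ true) σ 𝒱) (λ a → Partition.block 𝒱 a ≡ i)) σ 𝒱ᵢ x y →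
    ⊥
lemma7 n E σ _ proper 𝒱 h i 𝒱ᵢ hᵢ x y xy∈U xy∈Uᵢ =
  Xor-both (x∈Vᵢ , y∈Vᵢ , inj₂ (xy∉E , xy∈U)) xy∈BMᵢ (xy∈Uᵢ Tᵢ Tᵢ∈)
  where
  Arc : Fin n → Fin n → Set
  Arc a b = E a b ≡ true
  Vᵢ : Fin n → Set
  Vᵢ a = Partition.block 𝒱 a ≡ i
  Vᵢ? : Decidable Vᵢ
  Vᵢ? a = Partition.block 𝒱 a ≟ᶠ i
  module 𝒱-edits = Edits 𝒱 (λ _ → yes tt) h Arc σ
  module 𝒱ᵢ-edits = Edits 𝒱ᵢ Vᵢ? hᵢ (Induced (Arc △ U-part Arc σ 𝒱) Vᵢ) σ
  endpoints = 𝒱ᵢ-edits.U-part-⊆ (λ (x∈Vᵢ , y∈Vᵢ , _) → x∈Vᵢ , y∈Vᵢ) xy∈Uᵢ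
  x∈Vᵢ = proj₁ endpoints
  y∈Vᵢ = proj₂ endpoints
  σx≢σy = 𝒱-edits.U-part-properlyColoured (proper _ _) xy∈U
  xy∉E = 𝒱-edits.U-part-inBlock-insertion (tt , x∈Vᵢ) (tt , y∈Vᵢ) σx≢σy xy∈U
  colourUnique = 𝒱-edits.U-part-inBlock-colourUnique (tt , x∈Vᵢ) (tt , y∈Vᵢ) σx≢σy xy∈U
  Tᵢ = proj₁ (exists-InTrees 𝒱ᵢ Vᵢ? hᵢ)
  Tᵢ∈ = proj₂ (exists-InTrees 𝒱ᵢ Vᵢ? hᵢ)
  Tᵢ-leaves = proj₁ (proj₂ Tᵢ∈)
  xy∈BMᵢ : BestMatch Tᵢ σ x y
  xy∈BMᵢ = colour-unique-BestMatch σ (proj₁ Tᵢ∈) (from (Tᵢ-leaves x) x∈Vᵢ) (from (Tᵢ-leaves y) y∈Vᵢ)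
             σx≢σy λ {y'} y'∈Tᵢ → colourUnique (tt , to (Tᵢ-leaves y') y'∈Tᵢ)
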